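{- Let $G$ be a finite connected graph, and consider the Robber Locating Game on $G$ with a fixed number of cops. Let $A$ be a deterministic cop strategy, and let $H_A$ be its cop strategy graph. Then $A$ is cop-winning if and only if $H_A$ is finite.
   Context: Robber Locating Game: an invisible robber first chooses a vertex of $G$. In each round, the cops first simultaneously probe vertices anywhere in $G$, each probe returning the graph distance from the probed vertex to the robber's current position; then the robber moves to an adjacent vertex or stays put. The robber set $R_i$ is the set of positions of the robber consistent with all information after the cops' probes in round $i$ (and before the robber moves); the extended robber set after the robber moves is $X_i$, the closed neighbourhood of $R_i$, with $X_0=V(G)$. The cops win when $|R_i|=1$. A strategy is cop-winning if it guarantees a win for the cops in finite time against every robber behaviour. A state $\phi$ is the collection of information available to the cops that may affect their probes (e.g. the (extended) robber set, round number, previous probe results); a deterministic cop strategy $A$ is a function assigning to each state the set of probes $A(\phi)$, with different probes exactly when states differ. The cop strategy graph $H_A$ is the rooted levelled graph whose vertices are states: it starts with the initial state, and there is an edge from a state $\phi_1$ on one level to a state $\phi_2$ on the next level, labelled by probe results, if and only if there is a valid set of probe results for the probes $A(\phi_1)$ that updates the state $\phi_1$ to $\phi_2$. A state is a leaf if and only if it is terminating, i.e. its robber set has size $1$. -}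

module Defs where

open import Data.Nat using (ℕ; zero; suc; pred; _≤_; _<_)
open import Data.Fin using (Fin; toℕ)
open import Data.Vec using (Vec)
open import Data.List using (List; length; take)
open import Data.List.Membership.Propositional using (_∈_)
open import Data.Product using (Σ; _×_; ∃)
open import Data.Sum using (_⊎_)
open import Relation.Nullary using (¬_)
open import Relation.Binary.PropositionalEquality using (_≡_)
import Data.Vec as Vec
import Data.List as List

Classical : Set₁
Classical = (P : Set) → P ⊎ ¬ P

record Graph (n : ℕ) : Set₁ where
  field
    Adj   : Fin n → Fin n → Set
    sym   : ∀ {u v} → Adj u v → Adj v u
    irrefl : ∀ {u} → ¬ Adj u u
open Graph public

data Walk {n : ℕ} (G : Graph n) : Fin n → Fin n → ℕ → Set where
  nil  : ∀ {u} → Walk G u u zero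
  cons : ∀ {u w v d} → Adj G u w → Walk G w v d → Walk G u v (suc d)

Connected : ∀ {n} → Graph n → Set
Connected {n} G = (u v : Fin n) → ∃ λ d → Walk G u v d

IsDist : ∀ {n} → Graph n → Fin n → Fin n → ℕ → Set
IsDist G u v d = Walk G u v d × (∀ e → Walk G u v e → d ≤ e)

Step : ∀ {n} → Graph n → Fin n → Fin n → Set
Step G u v = u ≡ v ⊎ Adj G u v

-- A robber behaviour: w i is the robber's position during round i+1.
LazyWalk : ∀ {n} → Graph n → (ℕ → Fin n) → Set
LazyWalk G w = ∀ i → Step G (w i) (w (suc i))

-- Probe results of one round, and the history of all probe results so far
-- (in chronological order).  A state is the history: its length is the round.
Results : ℕ → Set
Results k = Vec ℕ k

History : ℕ → Set
History k = List (Results k)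

-- A deterministic cop strategy: the probes played in the state given.
Strategy : ℕ → ℕ → Set
Strategy n k = History k → Vec (Fin n) k

module Game {n k : ℕ} (G : Graph n) (A : Strategy n k) where

  -- The robber walk w is consistent with (generates) history h:
  -- in round j+1 the probes A (first j results) return the distances to w j.
  Consistent : History k → (ℕ → Fin n) → Set
  Consistent h w = (j : Fin (length h)) (c : Fin k) →
    IsDist G (Vec.lookup (A (take (toℕ j) h)) c) (w (toℕ j))
             (Vec.lookup (List.lookup h j) c)

  Valid : History k → Set
  Valid h = Σ (ℕ → Fin n) λ w → LazyWalk G w × Consistent h w

  -- Robber set R_i after the probes of round i = length h.
  InRobberSet : History k → Fin n → Set
  InRobberSet h v = Σ (ℕ → Fin n) λ w →
    LazyWalk G w × Consistent h w × w (pred (length h)) ≡ v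

  Terminating : History k → Set
  Terminating h = Σ (Fin n) λ v → InRobberSet h v × (∀ u → InRobberSet h u → u ≡ v)

  -- Vertices of the cop strategy graph H_A: states reachable from the
  -- initial state [] through non-leaf states via valid probe results.
  InH : History k → Set
  InH h = Valid h × (∀ j → 1 ≤ j → j < length h → ¬ Terminating (take j h))

  HFinite : Set
  HFinite = Σ (List (History k)) λ L → ∀ h → InH h → h ∈ L

  CopWinning : Set
  CopWinning = (w : ℕ → Fin n) → LazyWalk G w →
    Σ (History k) λ h → 1 ≤ length h × Consistent h w × Terminating h

-- A robber behaviour is a sequence of vertices, and the history it produces in
-- the first m rounds depends only on its first m positions.  If H_A is finite,
-- its states have bounded length, so every robber is caught before that bound.
-- Conversely, if for some M no robber survives M rounds, every state of H_A is
-- the history of one of the finitely many M-prefixes, so H_A is finite;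
-- otherwise robbers surviving M rounds exist for every M and, by König's lemma
-- over the finite vertex set, a single robber survives forever.
module Submission where

open import Defs hiding (sym)
open import Data.Nat using (ℕ; zero; suc; _≤_; _<_; z≤n; s≤s; _≟_)
open import Data.Nat.Properties
open import Data.Nat.Induction using (<-wellFounded)
open import Induction.WellFounded using (Acc; acc)
open import Data.Fin using (Fin; toℕ; fromℕ<)
open import Data.Fin.Properties using (toℕ-fromℕ<; toℕ<n)
open import Data.Vec using (Vec)
import Data.Vec as Vec
open import Data.Vec.Properties using (lookup-map; tabulate∘lookup; tabulate-cong)
open import Data.List using (List; []; _∷_; length; take; _++_; _∷ʳ_; map; concatMap; allFin; upTo)
import Data.List as List
open import Data.List.Properties using (take-suc; take-all; length-++; ∷ʳ-injectiveʳ)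
open import Data.List.Extrema.Nat using (max; xs≤max)
import Data.List.Relation.Unary.All as All
open import Data.List.Membership.Propositional using (_∈_; lose)
open import Data.List.Membership.Propositional.Properties using (∈-allFin; ∈-map⁺; ∈-concatMap⁺; ∈-upTo⁺)
open import Data.Product using (_×_; ∃; _,_; proj₁; proj₂)
open import Data.Sum using (_⊎_; inj₁; inj₂)
open import Data.Empty using (⊥-elim)
open import Relation.Nullary using (¬_; yes; no)
open import Relation.Binary.PropositionalEquality
open import Function using (_∘_)
open import Function.Bundles using (_⇔_; mk⇔)

module _ (cl : Classical) where

  dne : {P : Set} → ¬ ¬ P → P
  dne {P} ¬¬p with cl P
  ... | inj₁ p  = p
  ... | inj₂ ¬p = ⊥-elim (¬¬p ¬p)

  ¬∀⇒∃¬ : {X : Set} {Q : X → Set} → ¬ (∀ x → Q x) → ∃ λ x → ¬ Q x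
  ¬∀⇒∃¬ ¬∀ = dne λ ¬∃ → ¬∀ λ x → dne λ ¬q → ¬∃ (x , ¬q)

  least-witness : (P : ℕ → Set) → ∀ {m} → P m → ∃ λ d → P d × (∀ e → P e → d ≤ e)
  least-witness P {m} = go m (<-wellFounded m)
    where
    go : ∀ m → Acc _<_ m → P m → ∃ λ d → P d × (∀ e → P e → d ≤ e)
    go m (acc smaller) pm with cl (∃ λ e → e < m × P e)
    ... | inj₁ (e , e<m , pe) = go e (smaller e<m) pe
    ... | inj₂ none = m , pm , λ e pe → ≮⇒≥ λ e<m → none (e , e<m , pe)

bounded-on-Fin : ∀ {n} (f : Fin n → ℕ) → ∃ λ B → ∀ v → f v ≤ B
bounded-on-Fin {n} f =
  max 0 (map f (allFin n)) , λ v → All.lookup (xs≤max 0 _) (∈-map⁺ f (∈-allFin v))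

take-++ˡ : ∀ {X : Set} {j} (xs ys : List X) → j ≤ length xs → take j (xs ++ ys) ≡ take j xs
take-++ˡ {j = zero}  xs       ys _         = refl
take-++ˡ {j = suc j} (x ∷ xs) ys (s≤s j≤) = cong (x ∷_) (take-++ˡ xs ys j≤)

module _ {X : Set} (g : List X → ℕ → X) where

  unfoldSnoc : ℕ → List X
  unfoldSnoc zero    = []
  unfoldSnoc (suc m) = unfoldSnoc m ∷ʳ g (unfoldSnoc m) m

  length-unfoldSnoc : ∀ m → length (unfoldSnoc m) ≡ m
  length-unfoldSnoc zero    = refl
  length-unfoldSnoc (suc m) =
    trans (length-++ (unfoldSnoc m)) (trans (+-comm _ 1) (cong suc (length-unfoldSnoc m)))

  take-unfoldSnoc : ∀ {j} m → j ≤ m → take j (unfoldSnoc m) ≡ unfoldSnoc j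
  take-unfoldSnoc zero z≤n = refl
  take-unfoldSnoc (suc m) j≤1+m with m≤n⇒m<n∨m≡n j≤1+m
  ... | inj₂ refl      = take-all (suc m) _ (≤-reflexive (length-unfoldSnoc (suc m)))
  ... | inj₁ (s≤s j≤m) =
    trans (take-++ˡ (unfoldSnoc m) _ (≤-trans j≤m (≤-reflexive (sym (length-unfoldSnoc m)))))
          (take-unfoldSnoc m j≤m)

  lookup-unfoldSnoc : ∀ m (j : Fin (length (unfoldSnoc m))) →
    List.lookup (unfoldSnoc m) j ≡ g (take (toℕ j) (unfoldSnoc m)) (toℕ j)
  lookup-unfoldSnoc m j = begin
    List.lookup xs j  ≡⟨ ∷ʳ-injectiveʳ (take i xs) (unfoldSnoc i) prefix ⟩
    g (unfoldSnoc i) i ≡⟨ cong (λ p → g p i) (take-unfoldSnoc m (<⇒≤ i<m)) ⟨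
    g (take i xs) i   ∎
    where
    open ≡-Reasoning
    xs = unfoldSnoc m
    i = toℕ j
    i<m : i < m
    i<m = subst (i <_) (length-unfoldSnoc m) (toℕ<n j)
    prefix : take i xs ∷ʳ List.lookup xs j ≡ unfoldSnoc i ∷ʳ g (unfoldSnoc i) i
    prefix = trans (sym (take-suc xs j)) (take-unfoldSnoc m i<m)

  unfoldSnoc-unique : (h : List X) →
    (∀ (j : Fin (length h)) → List.lookup h j ≡ g (take (toℕ j) h) (toℕ j)) →
    h ≡ unfoldSnoc (length h)
  unfoldSnoc-unique h follows = trans (sym (take-all _ h ≤-refl)) (prefixes (length h) ≤-refl)
    where
    prefixes : ∀ j → j ≤ length h → take j h ≡ unfoldSnoc j
    prefixes zero    _   = refl
    prefixes (suc j) j<ℓ = begin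
      take (suc j) h                     ≡⟨ cong (λ z → take (suc z) h) (toℕ-fromℕ< j<ℓ) ⟨
      take (suc (toℕ i)) h               ≡⟨ take-suc h i ⟩
      take (toℕ i) h ∷ʳ List.lookup h i  ≡⟨ cong (take (toℕ i) h ∷ʳ_) (follows i) ⟩
      take (toℕ i) h ∷ʳ g (take (toℕ i) h) (toℕ i)
                                         ≡⟨ cong (λ z → take z h ∷ʳ g (take z h) z) (toℕ-fromℕ< j<ℓ) ⟩
      take j h ∷ʳ g (take j h) j         ≡⟨ cong (λ p → p ∷ʳ g p j) (prefixes j (<⇒≤ j<ℓ)) ⟩
      unfoldSnoc (suc j)                 ∎
      where
      open ≡-Reasoning
      i = fromℕ< j<ℓ

AgreeBelow : {X : Set} → ℕ → (ℕ → X) → (ℕ → X) → Set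
AgreeBelow m w w' = ∀ i → i < m → w i ≡ w' i

unfoldSnoc-cong : ∀ {X : Set} {g g' : List X → ℕ → X} m →
  (∀ h j → j < m → g h j ≡ g' h j) → unfoldSnoc g m ≡ unfoldSnoc g' m
unfoldSnoc-cong zero    _  = refl
unfoldSnoc-cong {g = g} (suc m) eq = cong₂ _∷ʳ_ ih (trans (cong (λ p → g p m) ih) (eq _ m ≤-refl))
  where
  ih = unfoldSnoc-cong m λ h j j<m → eq h j (m<n⇒m<1+n j<m)

_[_]≔_ : {X : Set} → (ℕ → X) → ℕ → X → ℕ → X
(w [ m ]≔ v) i with i ≟ m
... | yes _ = v
... | no  _ = w i

[]≔-below : ∀ {X : Set} (w : ℕ → X) m v → AgreeBelow m w (w [ m ]≔ v)
[]≔-below w m v i i<m with i ≟ m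
... | yes refl = ⊥-elim (<-irrefl refl i<m)
... | no  _    = refl

[]≔-at : ∀ {X : Set} (w : ℕ → X) m v → (w [ m ]≔ v) m ≡ v
[]≔-at w m v with m ≟ m
... | yes _   = refl
... | no  m≢m = ⊥-elim (m≢m refl)

AgreeBelow-[]≔ : ∀ {X : Set} {m} {w w' : ℕ → X} → AgreeBelow m w w' →
  AgreeBelow (suc m) (w [ m ]≔ w' m) w'
AgreeBelow-[]≔ {m = m} {w} {w'} agree i i<1+m with m≤n⇒m<n∨m≡n (≤-pred i<1+m)
... | inj₁ i<m  = trans (sym ([]≔-below w m (w' m) i i<m)) (agree i i<m)
... | inj₂ refl = []≔-at w i (w' i)

_◂_ : {X : Set} → X → (ℕ → X) → ℕ → X
(v ◂ w) zero    = v
(v ◂ w) (suc i) = w i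

prefixRepresentatives : ∀ {n} → ℕ → List (ℕ → Fin n)
prefixRepresentatives {n} zero    = map (λ v _ → v) (allFin n)
prefixRepresentatives {n} (suc m) =
  concatMap (λ v → map (v ◂_) (prefixRepresentatives m)) (allFin n)

prefixRepresentatives-complete : ∀ {n} m (w : ℕ → Fin n) →
  ∃ λ w' → w' ∈ prefixRepresentatives m × AgreeBelow m w w'
prefixRepresentatives-complete zero w = _ , ∈-map⁺ (λ v _ → v) (∈-allFin (w 0)) , λ _ ()
prefixRepresentatives-complete (suc m) w =
  let w' , w'∈ , agree = prefixRepresentatives-complete m (λ i → w (suc i)) in
  w 0 ◂ w' ,
  ∈-concatMap⁺ (λ v → map (v ◂_) (prefixRepresentatives m))
               (lose (∈-allFin (w 0)) (∈-map⁺ (w 0 ◂_) w'∈)) ,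
  λ { zero _ → refl ; (suc i) (s≤s i<m) → agree i i<m }

module WeakKönig (cl : Classical) {n} (P : ℕ → (ℕ → Fin n) → Set)
  (P-local : ∀ M {w w'} → AgreeBelow M w w' → P M w → P M w')
  (P-antitone : ∀ {M M'} w → M ≤ M' → P M' w → P M w) where

  Extendable : ℕ → (ℕ → Fin n) → Set
  Extendable m w = ∀ M → ∃ λ w' → AgreeBelow m w w' × P M w'

  extend : ∀ {m w} → Extendable m w → ∃ λ v → Extendable (suc m) (w [ m ]≔ v)
  -- An obstruction M_v for every choice of v is refuted by the m-th term of a
  -- witness for the largest M_v.
  extend {m} {w} extendable = dne cl λ none →
    let obstruction v = ¬∀⇒∃¬ cl λ e → none (v , e)
        B , bound = bounded-on-Fin (λ v → proj₁ (obstruction v))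
        w' , agree , pB = extendable B
        v = w' m
    in proj₂ (obstruction v) (w' , AgreeBelow-[]≔ agree , P-antitone w' (bound v) pB)

  weak-König : (∀ M → ∃ (P M)) → ∃ λ W → ∀ M → P M W
  weak-König witnesses = W , λ M →
    let w' , agree , pM = proj₂ (approximant M) M in
    P-local M (λ i i<M → trans (sym (agree i i<M)) (approximant-agree M i i<M)) pM
    where
    approximant : ∀ m → ∃ (Extendable m)
    approximant zero    = proj₁ (witnesses 0) , λ M → proj₁ (witnesses M) , (λ _ ()) , proj₂ (witnesses M)
    approximant (suc m) = let w , e = approximant m ; v , e' = extend e in w [ m ]≔ v , e'

    W : ℕ → Fin n
    W i = proj₁ (approximant (suc i)) i

    approximant-agree : ∀ m → AgreeBelow m (proj₁ (approximant m)) W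
    approximant-agree (suc m) i i<1+m with m≤n⇒m<n∨m≡n (≤-pred i<1+m)
    ... | inj₂ refl = refl
    ... | inj₁ i<m  = trans (sym ([]≔-below (proj₁ (approximant m)) m _ i i<m)) (approximant-agree m i i<m)

IsDist-unique : ∀ {n} {G : Graph n} {u v d e} → IsDist G u v d → IsDist G u v e → d ≡ e
IsDist-unique (walk-d , least-d) (walk-e , least-e) = ≤-antisym (least-d _ walk-e) (least-e _ walk-d)

module Play (cl : Classical) {n k : ℕ} (G : Graph n) (conn : Connected G) (A : Strategy n k) where
  open Game G A

  distance : Fin n → Fin n → ℕ
  distance u v = proj₁ (least-witness cl (Walk G u v) (proj₂ (conn u v)))

  distance-isDist : ∀ u v → IsDist G u v (distance u v)
  distance-isDist u v = proj₂ (least-witness cl (Walk G u v) (proj₂ (conn u v)))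

  probeResults : Vec (Fin n) k → Fin n → Results k
  probeResults ps x = Vec.map (λ p → distance p x) ps

  isDist⇒probeResults : ∀ ps x r → (∀ c → IsDist G (Vec.lookup ps c) x (Vec.lookup r c)) →
    r ≡ probeResults ps x
  isDist⇒probeResults ps x r isDist = begin
    r                               ≡⟨ tabulate∘lookup r ⟨
    Vec.tabulate (Vec.lookup r)     ≡⟨ tabulate-cong entries ⟩
    Vec.tabulate (Vec.lookup rs)    ≡⟨ tabulate∘lookup rs ⟩
    rs                              ∎
    where
    open ≡-Reasoning
    rs = probeResults ps x
    entries : ∀ c → Vec.lookup r c ≡ Vec.lookup rs c
    entries c = trans (IsDist-unique (isDist c) (distance-isDist _ x)) (sym (lookup-map c _ ps))

  probeResults-isDist : ∀ ps x c → IsDist G (Vec.lookup ps c) x (Vec.lookup (probeResults ps x) c)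
  probeResults-isDist ps x c = subst (IsDist G _ x) (sym (lookup-map c _ ps)) (distance-isDist _ x)

  history : (ℕ → Fin n) → ℕ → History k
  history w = unfoldSnoc λ h j → probeResults (A h) (w j)

  length-history : ∀ w m → length (history w m) ≡ m
  length-history w = length-unfoldSnoc _

  take-history : ∀ w {j} m → j ≤ m → take j (history w m) ≡ history w j
  take-history w = take-unfoldSnoc _

  history-consistent : ∀ w m → Consistent (history w m) w
  history-consistent w m j c rewrite lookup-unfoldSnoc (λ h j → probeResults (A h) (w j)) m j =
    probeResults-isDist (A (take (toℕ j) (history w m))) (w (toℕ j)) c

  consistent⇒history : ∀ {h w} → Consistent h w → h ≡ history w (length h)
  consistent⇒history {h} {w} consistent =
    unfoldSnoc-unique _ h λ j → isDist⇒probeResults _ _ _ (consistent j)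

  history-cong : ∀ {w w'} m → AgreeBelow m w w' → history w m ≡ history w' m
  history-cong m agree = unfoldSnoc-cong m λ h j j<m → cong (probeResults (A h)) (agree j j<m)

  Evades : ℕ → (ℕ → Fin n) → Set
  Evades M w = ∀ j → 1 ≤ j → j < M → ¬ Terminating (history w j)

  LazyBelow : ℕ → (ℕ → Fin n) → Set
  LazyBelow M w = ∀ i → suc i < M → Step G (w i) (w (suc i))

  EvadesLazily : ℕ → (ℕ → Fin n) → Set
  EvadesLazily M w = LazyBelow M w × Evades M w

  EvadesLazily-local : ∀ M {w w'} → AgreeBelow M w w' → EvadesLazily M w → EvadesLazily M w'
  EvadesLazily-local M agree (lazy , evades) =
    (λ i i+1<M → subst₂ (Step G) (agree i (<-trans (n<1+n i) i+1<M)) (agree (suc i) i+1<M) (lazy i i+1<M)) ,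
    λ j 1≤j j<M → evades j 1≤j j<M ∘ subst Terminating
      (sym (history-cong j λ i i<j → agree i (<-trans i<j j<M)))

  EvadesLazily-antitone : ∀ {M M'} w → M ≤ M' → EvadesLazily M' w → EvadesLazily M w
  EvadesLazily-antitone w M≤M' (lazy , evades) =
    (λ i i+1<M → lazy i (≤-trans i+1<M M≤M')) , λ j 1≤j j<M → evades j 1≤j (≤-trans j<M M≤M')

  InH⇒evades : ∀ {h} → InH h → ∃ λ w → LazyWalk G w × Evades (length h) w
  InH⇒evades {h} ((w , lazy , consistent) , nonterminating) =
    w , lazy , λ j 1≤j j<ℓ → nonterminating j 1≤j j<ℓ ∘ subst Terminating (sym (prefix j<ℓ))
    where
    prefix : ∀ {j} → j < length h → take j h ≡ history w j
    prefix {j} j<ℓ = trans (cong (take j) (consistent⇒history consistent)) (take-history w _ (<⇒≤ j<ℓ))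

  evades⇒InH : ∀ {w M} → LazyWalk G w → Evades M w → InH (history w M)
  evades⇒InH {w} {M} lazy evades =
    (w , lazy , history-consistent w M) ,
    λ j 1≤j j<ℓ → let j<M = subst (j <_) (length-history w M) j<ℓ in
      evades j 1≤j j<M ∘ subst Terminating (take-history w M (<⇒≤ j<M))

  caught-or-evades : ∀ w M → (∃ λ j → 1 ≤ j × j < M × Terminating (history w j)) ⊎ Evades M w
  caught-or-evades w M with cl (∃ λ j → 1 ≤ j × j < M × Terminating (history w j))
  ... | inj₁ caught = inj₁ caught
  ... | inj₂ none   = inj₂ λ j 1≤j j<M t → none (j , 1≤j , j<M , t)

  finite⇒bounded : HFinite → ∃ λ M → ∀ h → InH h → length h ≤ M
  finite⇒bounded (L , complete) =
    max 0 (map length L) , λ h inH → All.lookup (xs≤max 0 _) (∈-map⁺ length (complete h inH))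

  finite⇒copWinning : HFinite → CopWinning
  finite⇒copWinning finite w lazy with finite⇒bounded finite
  ... | M , bounded with caught-or-evades w (suc M)
  ... | inj₁ (j , 1≤j , _ , t) =
    history w j , subst (1 ≤_) (sym (length-history w j)) 1≤j , history-consistent w j , t
  ... | inj₂ evades =
    ⊥-elim (1+n≰n (subst (_≤ M) (length-history w (suc M)) (bounded _ (evades⇒InH lazy evades))))

  bounded⇒finite : ∀ M → (∀ h → InH h → length h ≤ M) → HFinite
  bounded⇒finite M bounded = concatMap historiesOfLength (upTo (suc M)) , complete
    where
    historiesOfLength : ℕ → List (History k)
    historiesOfLength ℓ = map (λ w → history w ℓ) (prefixRepresentatives M)
    complete : ∀ h → InH h → h ∈ concatMap historiesOfLength (upTo (suc M))
    complete h inH@((w , _ , consistent) , _) =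
      let ℓ≤M = bounded h inH
          w' , w'∈ , agree = prefixRepresentatives-complete M w
          h≡ = trans (consistent⇒history consistent)
                     (history-cong (length h) λ i i<ℓ → agree i (≤-trans i<ℓ ℓ≤M))
      in subst (_∈ _) (sym h≡)
           (∈-concatMap⁺ historiesOfLength (lose (∈-upTo⁺ (s≤s ℓ≤M)) (∈-map⁺ _ w'∈)))

  never-caught : ∀ {W} → (∀ M → EvadesLazily M W) → ¬ CopWinning
  never-caught {W} evades cw =
    let h , 1≤ℓ , consistent , t = cw W (λ i → proj₁ (evades (suc (suc i))) i ≤-refl) in
    proj₂ (evades (suc (length h))) (length h) 1≤ℓ ≤-refl
          (subst Terminating (consistent⇒history consistent) t)

  copWinning⇒finite : CopWinning → HFinite
  copWinning⇒finite cw with cl (∃ λ M → ¬ ∃ (EvadesLazily M))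
  ... | inj₁ (M , none) = bounded⇒finite M λ h inH → ≮⇒≥ λ M<ℓ →
    let w , lazy , evades = InH⇒evades inH in
    none (w , EvadesLazily-antitone w (<⇒≤ M<ℓ) ((λ i _ → lazy i) , evades))
  ... | inj₂ unbounded =
    ⊥-elim (never-caught (proj₂ (weak-König λ M → dne cl λ ¬e → unbounded (M , ¬e))) cw)
    where open WeakKönig cl EvadesLazily EvadesLazily-local EvadesLazily-antitone

theorem1 : Classical → (n k : ℕ) (G : Graph n) → Connected G →
    (A : Strategy n k) → Game.CopWinning G A ⇔ Game.HFinite G A
theorem1 cl n k G conn A = mk⇔ copWinning⇒finite finite⇒copWinning
  where open Play cl G conn A
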